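{- For all $n \ge 0$ and $k \ge 0$, $P(n,k) = P(n,1)^k = \{\pi_1 \circ \cdots \circ \pi_k : \pi_1,\ldots,\pi_k \in P(n,1)\}$.
   Context: A system of $k$ stacks in series consists of an input queue, stacks $1,\ldots,k$, and an output queue; the legal moves are: move the front element of the input queue onto stack 1, pop the top of stack $i$ and push it onto stack $i+1$ ($1\le i<k$), and pop the top of stack $k$ and enqueue it on the output queue. A permutation $\pi \in S_n$ is generated by $k$ stacks if, starting with input queue (front to back) $1,\ldots,n$ and all stacks and the output queue empty, some finite sequence of legal moves ends with all elements in the output queue in order (front to back) $\pi(1),\ldots,\pi(n)$. $P(n,k) \subseteq S_n$ is the set of permutations generated by $k$ stacks. For sets $A,B \subseteq S_n$, $AB = \{ab : a\in A, b\in B\}$ and $A^k$ is the $k$-fold product. -}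

module Defs where

open import Data.Nat using (ℕ; zero; suc)
open import Data.Fin using (Fin)
open import Data.List using (List; []; _∷_; _++_; [_]; allFin)
open import Data.Vec using (Vec; []; _∷_; replicate; tabulate; lookup; toList)
open import Data.Product using (Σ; _×_; _,_)
open import Relation.Binary.PropositionalEquality using (_≡_)
open import Relation.Binary.Construct.Closure.ReflexiveTransitive using (Star)

-- A configuration of the system of k stacks in series:
-- input queue (front = head), stacks 1..k (top = head of each list),
-- output queue (front = head; enqueueing appends at the end).
record Config (A : Set) (k : ℕ) : Set where
  constructor cfg
  field
    input  : List A
    stacks : Vec (List A) k
    output : List A

data Shift {A : Set} : {k : ℕ} → Vec (List A) k → Vec (List A) k → Set where
  here  : ∀ {k} x s t (ss : Vec (List A) k) →
          Shift ((x ∷ s) ∷ t ∷ ss) (s ∷ (x ∷ t) ∷ ss)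
  there : ∀ {k} s {ss ss' : Vec (List A) k} →
          Shift ss ss' → Shift (s ∷ ss) (s ∷ ss')

data PopLast {A : Set} : {k : ℕ} → Vec (List A) k → A → Vec (List A) k → Set where
  last  : ∀ x s → PopLast ((x ∷ s) ∷ []) x (s ∷ [])
  there : ∀ {k} s {ss ss' : Vec (List A) (suc k)} {x} →
          PopLast ss x ss' → PopLast (s ∷ ss) x (s ∷ ss')

-- Legal moves.  For k = 0 (no stacks) the only move transfers the front
-- of the input queue directly to the output queue.
data Move {A : Set} : {k : ℕ} → Config A k → Config A k → Set where
  direct : ∀ x xs out →
           Move {k = 0} (cfg (x ∷ xs) [] out) (cfg xs [] (out ++ [ x ]))
  push   : ∀ {k} x xs s (ss : Vec (List A) k) out →
           Move (cfg (x ∷ xs) (s ∷ ss) out) (cfg xs ((x ∷ s) ∷ ss) out)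
  shift  : ∀ {k} inp {ss ss' : Vec (List A) k} out →
           Shift ss ss' → Move (cfg inp ss out) (cfg inp ss' out)
  pop    : ∀ {k} inp {ss ss' : Vec (List A) (suc k)} {x} out →
           PopLast ss x ss' → Move (cfg inp ss out) (cfg inp ss' (out ++ [ x ]))

-- A permutation of Fin n in one-line notation: π(1), ..., π(n).
Word : ℕ → Set
Word n = Vec (Fin n) n

-- P(n,k): π is generated by k stacks: starting from input 1..n (i.e. 0..n-1)
-- with empty stacks and output, some finite sequence of legal moves ends
-- with everything in the output queue in order π(1),...,π(n).
Generated : (n k : ℕ) → Word n → Set
Generated n k π =
  Star Move (cfg (allFin n) (replicate k []) [])
            (cfg [] (replicate k []) (toList π))

_∘ₚ_ : ∀ {n} → Word n → Word n → Word n
a ∘ₚ b = tabulate (λ i → lookup a (lookup b i))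

idₚ : ∀ {n} → Word n
idₚ = tabulate (λ i → i)

Pow : ∀ {n} → ℕ → (Word n → Set) → Word n → Set
Pow zero    A π = π ≡ idₚ
Pow (suc k) A π = Σ _ λ a → Σ _ λ b → A a × Pow k A b × (π ≡ a ∘ₚ b)

-- In a run of k + 1 stacks in series, the sequence of elements leaving stack 1
-- is an intermediate word a: the run splits into a one-stack run turning 1..n
-- into a and a k-stack run on input a, and conversely any two such runs
-- interleave into a single run.  Stacks only move elements around, so a k-stack
-- run on input a = a ∘ id is the relabelling by a of a k-stack run on 1..n,
-- whose output is some b ∈ P(n,k); the composite output is a ∘ b.  Induction on
-- k gives P(n,k+1) = P(n,1) P(n,k).
module Submission where

open import Defs
open import Data.Nat using (ℕ; zero; suc; _+_)
open import Data.Nat.Properties using (+-suc; +-identityʳ)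
open import Data.Fin as Fin using (Fin)
open import Data.List as List using (List; []; _∷_; _++_; [_]; allFin; length; map)
open import Data.List.Properties using (++-assoc; ++-identityʳ; length-map; length-tabulate)
open import Data.Vec as Vec using (Vec; []; _∷_; replicate; tabulate; lookup; toList; fromList; cast)
open import Data.Vec.Properties
  using (toList-injective; cast-is-id; toList-map; toList-cast; toList∘fromList; tabulate-∘; tabulate∘lookup; map-lookup-allFin; length-toList)
open import Data.Product using (∃-syntax; _×_; _,_)
open import Function.Base using (_∘_; id)
open import Function.Bundles using (_⇔_; mk⇔)
open import Relation.Binary.PropositionalEquality using (_≡_; refl; sym; trans; cong; subst; subst₂; module ≡-Reasoning)
open import Relation.Binary.Construct.Closure.ReflexiveTransitive using (Star; ε; _◅_)

module _ {A : Set} where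

  Serial : ℕ → List A → List A → Set
  Serial k xs zs = Star Move (cfg xs (replicate k []) []) (cfg [] (replicate k []) zs)

  -- Emits xs s ys: a single stack holding s, fed the input xs, can pop exactly
  -- the sequence ys.  Unlike a run of Move it does not record the output so
  -- far, which is what lets runs be split and merged at the first stack.
  data Emits : List A → List A → List A → Set where
    done : Emits [] [] []
    push : ∀ {x xs s ys} → Emits xs (x ∷ s) ys → Emits (x ∷ xs) s ys
    pop  : ∀ {x xs s ys} → Emits xs s ys → Emits xs (x ∷ s) (x ∷ ys)

  Emits-length : ∀ {xs s ys} → Emits xs s ys → length ys ≡ length xs + length s
  Emits-length done = refl
  Emits-length (push {xs = xs} {s} e) = trans (Emits-length e) (+-suc (length xs) (length s))
  Emits-length (pop {xs = xs} {s} e) = trans (cong suc (Emits-length e)) (sym (+-suc (length xs) (length s)))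

  split-first : ∀ {k inp s} {ss : Vec (List A) k} {out zs} →
    Star Move (cfg inp (s ∷ ss) out) (cfg [] (replicate (suc k) []) zs) →
    ∃[ mid ] Emits inp s mid × Star Move (cfg mid ss out) (cfg [] (replicate k []) zs)
  split-first ε = [] , done , ε
  split-first (push x xs s ss out ◅ r) with split-first r
  ... | mid , e , rest = mid , push e , rest
  split-first (shift inp out (here x s t ss) ◅ r) with split-first r
  ... | mid , e , rest = x ∷ mid , pop e , push x mid t ss out ◅ rest
  split-first (shift inp out (there s sh) ◅ r) with split-first r
  ... | mid , e , rest = mid , e , shift mid out sh ◅ rest
  split-first (pop inp out (last x s) ◅ r) with split-first r
  ... | mid , e , rest = x ∷ mid , pop e , direct x mid out ◅ rest
  split-first (pop inp out (there s pl) ◅ r) with split-first r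
  ... | mid , e , rest = mid , e , pop mid out pl ◅ rest

  merge-first : ∀ {k inp s mid} {ss : Vec (List A) k} {out zs} →
    Emits inp s mid → Star Move (cfg mid ss out) (cfg [] (replicate k []) zs) →
    Star Move (cfg inp (s ∷ ss) out) (cfg [] (replicate (suc k) []) zs)
  merge-first done ε = ε
  merge-first e (shift _ out sh ◅ r) = shift _ out (there _ sh) ◅ merge-first e r
  merge-first e (pop _ out pl ◅ r) = pop _ out (there _ pl) ◅ merge-first e r
  merge-first (push e) r = push _ _ _ _ _ ◅ merge-first e r
  merge-first (pop e) (push x xs t ts out ◅ r) = shift _ out (here x _ t ts) ◅ merge-first e r
  merge-first (pop e) (direct x xs out ◅ r) = pop _ out (last x _) ◅ merge-first e r

  zero-stacks-copy : ∀ xs o → Star (Move {A} {0}) (cfg xs [] o) (cfg [] [] (o ++ xs))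
  zero-stacks-copy [] o = subst (λ zs → Star Move (cfg [] [] o) (cfg [] [] zs)) (sym (++-identityʳ o)) ε
  zero-stacks-copy (x ∷ xs) o =
    direct x xs o ◅ subst (λ zs → Star Move (cfg xs [] (o ++ [ x ])) (cfg [] [] zs))
                          (++-assoc o [ x ] xs) (zero-stacks-copy xs (o ++ [ x ]))

  zero-stacks-output : ∀ {xs o zs} → Star (Move {A} {0}) (cfg xs [] o) (cfg [] [] zs) → zs ≡ o ++ xs
  zero-stacks-output {o = o} ε = sym (++-identityʳ o)
  zero-stacks-output (direct x xs o ◅ r) = trans (zero-stacks-output r) (++-assoc o [ x ] xs)
  zero-stacks-output (shift _ _ () ◅ r)

  Emits⇒Serial-one : ∀ {xs ys} → Emits xs [] ys → Serial 1 xs ys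
  Emits⇒Serial-one {ys = ys} e = merge-first e (zero-stacks-copy ys [])

  Serial-one⇒Emits : ∀ {xs ys} → Serial 1 xs ys → Emits xs [] ys
  Serial-one⇒Emits r with split-first r
  ... | _ , e , rest = subst (Emits _ []) (sym (zero-stacks-output rest)) e

module _ {A B : Set} (f : A → B) where

  Emits-map : ∀ {xs s ys} → Emits xs s ys → Emits (map f xs) (map f s) (map f ys)
  Emits-map done = done
  Emits-map (push e) = push (Emits-map e)
  Emits-map (pop e) = pop (Emits-map e)

  Emits-lift : ∀ xs s {ys′} → Emits (map f xs) (map f s) ys′ → ∃[ ys ] Emits xs s ys × map f ys ≡ ys′
  Emits-lift [] [] done = [] , done , refl
  Emits-lift xs (x ∷ s) (pop e) with Emits-lift xs s e
  ... | ys , e′ , eq = x ∷ ys , pop e′ , cong (f x ∷_) eq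
  Emits-lift (x ∷ xs) s (push e) with Emits-lift xs (x ∷ s) e
  ... | ys , e′ , eq = ys , push e′ , eq

  Serial-map : ∀ k {xs zs} → Serial k xs zs → Serial k (map f xs) (map f zs)
  Serial-map zero {xs} r =
    subst (Serial 0 (map f xs) ∘ map f) (sym (zero-stacks-output r)) (zero-stacks-copy (map f xs) [])
  Serial-map (suc k) r with split-first r
  ... | mid , e , rest = merge-first (Emits-map e) (Serial-map k rest)

  Serial-lift : ∀ k xs {zs′} → Serial k (map f xs) zs′ → ∃[ zs ] Serial k xs zs × map f zs ≡ zs′
  Serial-lift zero xs r = xs , zero-stacks-copy xs [] , sym (zero-stacks-output r)
  Serial-lift (suc k) xs r with split-first r
  ... | _ , e , rest with Emits-lift xs [] e
  ... | mid , e′ , refl with Serial-lift k mid rest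
  ... | zs , rest′ , eq = zs , merge-first e′ rest′ , eq

toList-tabulate : ∀ {A : Set} {n} (f : Fin n → A) → toList (tabulate f) ≡ List.tabulate f
toList-tabulate {n = zero} f = refl
toList-tabulate {n = suc n} f = cong (f Fin.zero ∷_) (toList-tabulate (f ∘ Fin.suc))

toList-surjective : ∀ {A : Set} {n} (ys : List A) → length ys ≡ n → ∃[ v ] toList {n = n} v ≡ ys
toList-surjective ys eq = cast eq (fromList ys) , trans (toList-cast eq (fromList ys)) (toList∘fromList ys)

toList-injective′ : ∀ {A : Set} {n} {u v : Vec A n} → toList u ≡ toList v → u ≡ v
toList-injective′ {u = u} {v} eq = trans (sym (cast-is-id refl u)) (toList-injective refl u v eq)

module _ {n : ℕ} where

  toList-idₚ : toList (idₚ {n}) ≡ allFin n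
  toList-idₚ = toList-tabulate id

  toList≡map-lookup : (a : Word n) → toList a ≡ map (lookup a) (allFin n)
  toList≡map-lookup a = begin
    toList a                                    ≡⟨ cong toList (map-lookup-allFin a) ⟨
    toList (Vec.map (lookup a) (Vec.allFin n))  ≡⟨ toList-map (lookup a) (Vec.allFin n) ⟩
    map (lookup a) (toList (Vec.allFin n))      ≡⟨ cong (map (lookup a)) (toList-tabulate id) ⟩
    map (lookup a) (allFin n)                   ∎
    where open ≡-Reasoning

  toList-∘ₚ : (a b : Word n) → toList (a ∘ₚ b) ≡ map (lookup a) (toList b)
  toList-∘ₚ a b = begin
    toList (tabulate (lookup a ∘ lookup b))         ≡⟨ cong toList (tabulate-∘ (lookup a) (lookup b)) ⟩
    toList (Vec.map (lookup a) (tabulate (lookup b))) ≡⟨ cong (toList ∘ Vec.map (lookup a)) (tabulate∘lookup b) ⟩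
    toList (Vec.map (lookup a) b)                   ≡⟨ toList-map (lookup a) b ⟩
    map (lookup a) (toList b)                       ∎
    where open ≡-Reasoning

  Generated-suc⇒ : ∀ k {π} → Generated n (suc k) π → ∃[ a ] Generated n 1 a × Serial k (toList a) (toList π)
  Generated-suc⇒ k r with split-first r
  ... | mid , e , rest with toList-surjective mid length-mid
    where
    length-mid : length mid ≡ n
    length-mid = trans (Emits-length e) (trans (+-identityʳ _) (length-tabulate id))
  ... | a , refl = a , Emits⇒Serial-one e , rest

  Serial-relabel : ∀ k {a b : Word n} → Serial k (allFin n) (toList b) → Serial k (toList a) (toList (a ∘ₚ b))
  Serial-relabel k {a} {b} r =
    subst₂ (Serial k) (sym (toList≡map-lookup a)) (sym (toList-∘ₚ a b)) (Serial-map (lookup a) k r)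

  Serial-relabel⁻ : ∀ k {a π : Word n} → Serial k (toList a) (toList π) →
    ∃[ b ] Serial k (allFin n) (toList b) × π ≡ a ∘ₚ b
  Serial-relabel⁻ k {a} {π} r
    with Serial-lift (lookup a) k (allFin n) (subst (λ xs → Serial k xs (toList π)) (toList≡map-lookup a) r)
  ... | ws , r′ , eq with toList-surjective ws length-ws
    where
    length-ws : length ws ≡ n
    length-ws = trans (sym (length-map (lookup a) ws)) (trans (cong length eq) (length-toList π))
  ... | b , refl = b , r′ , toList-injective′ (trans (sym eq) (sym (toList-∘ₚ a b)))

  Generated⇒Pow : ∀ k π → Generated n k π → Pow k (Generated n 1) π
  Generated⇒Pow zero π r = toList-injective′ (trans (zero-stacks-output r) (sym toList-idₚ))
  Generated⇒Pow (suc k) π r with Generated-suc⇒ k r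
  ... | a , g , rest with Serial-relabel⁻ k rest
  ... | b , r′ , refl = a , b , g , Generated⇒Pow k b r′ , refl

  Pow⇒Generated : ∀ k π → Pow k (Generated n 1) π → Generated n k π
  Pow⇒Generated zero π refl = subst (Serial 0 (allFin n)) (sym toList-idₚ) (zero-stacks-copy (allFin n) [])
  Pow⇒Generated (suc k) π (a , b , g , p , refl) =
    merge-first (Serial-one⇒Emits g) (Serial-relabel k (Pow⇒Generated k b p))

lemma2 : (n k : ℕ) (π : Word n) → Generated n k π ⇔ Pow k (Generated n 1) π
lemma2 n k π = mk⇔ (Generated⇒Pow k π) (Pow⇒Generated k π)
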